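{- Let $p$ be a prime, let $l$ and $d$ be positive integers, and let $N = p^l$. If $A \subseteq \mathbb{Z}_N$ is $\{x,2x,\ldots,(p^d-1)x\}$-free, then $$|A| \leqslant \Big(1 - \frac{1}{p^d-1}\Big)N.$$
   Context: For a positive integer $m$, a set $A \subseteq \mathbb{Z}_N$ is $\{x,2x,\ldots,mx\}$-free if there is no $x \in \mathbb{Z}_N$ with $\{x,2x,\ldots,mx\} \subseteq A$ (multiplication taken modulo $N$). -}

module Defs where

open import Data.Nat using (ℕ; suc; _*_; _%_; _≤_; NonZero)
open import Data.Fin using (Fin; toℕ; fromℕ<)
open import Data.Fin.Subset using (Subset; _∈_)
open import Data.Nat.DivMod using (m%n<n)
open import Data.Product using (∃)
open import Relation.Nullary using (¬_)

_·_ : ∀ {N} .{{_ : NonZero N}} → ℕ → Fin N → Fin N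
_·_ {N} k x = fromℕ< (m%n<n (k * toℕ x) N)

MultFree : ∀ {N} .{{_ : NonZero N}} → ℕ → Subset N → Set
MultFree {N} m A = ¬ (∃ λ (x : Fin N) → ∀ k → 1 ≤ k → k ≤ m → (k · x) ∈ A)

open import Data.Nat using (_^_)
open import Data.Nat.Primality using (Prime; prime⇒nonZero)
open import Data.Nat.Properties using (m^n≢0)

prime^≢0 : ∀ {p} → Prime p → (l : ℕ) → NonZero (p ^ l)
prime^≢0 {p} pr l = m^n≢0 p l {{prime⇒nonZero pr}}

-- Let B be the complement of A and m = p^d - 1; freeness says that B meets {x, 2x, …, mx} for
-- every x, and we show p^l ≤ m |B| by induction on l in steps of d.  Count the pairs (k, x) with
-- 0 < k < p^d, x a unit of ℤ_N and kx ∈ B: every unit x gives at least one pair, while every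
-- y ∈ B not divisible by p^d arises from exactly p^(d-1) (p - 1) pairs.  Hence at least p^(l-d)
-- elements of B lie outside p^d ℤ_N.  Those inside, divided by p^d, form a subset of ℤ_{p^(l-d)}
-- with the same hitting property, so by induction there are at least p^(l-d) / m of them, and
-- |B| ≥ p^(l-d) (1 + 1/m) = p^l / m.
module Submission where

open import Defs
open import Data.Bool using (Bool; true; false)
open import Data.Empty using (⊥-elim)
open import Data.Fin using (Fin; toℕ; fromℕ<)
open import Data.Fin.Permutation using (Permutation; permutation)
open import Data.Fin.Subset using (Subset; ∣_∣; _∈_; ∁; inside; outside)
open import Data.Fin.Subset.Properties using (_∈?_; x∉p⇒x∈∁p; ∣∁p∣≡n∸∣p∣; ∣p∣≤n)
import Data.Fin.Properties as Fin
open import Data.Nat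
open import Data.Nat.Properties
open import Data.Nat.Coprimality using (Coprime; coprime-Bézout; coprime-divisor; prime⇒coprime)
open import Data.Nat.Divisibility using (∣-trans; ∣1⇒≡1; ∣m+n∣m⇒∣n; n∣m*n)
open import Data.Nat.DivMod
open import Data.Nat.GCD using (module Bézout)
open import Data.Nat.GeneralisedArithmetic using (iterate)
open import Data.Nat.Induction using (<-rec)
open import Data.Nat.Primality using (Prime; prime⇒nonTrivial; prime⇒nonZero)
open import Data.Product using (∃; _×_; _,_)
open import Data.Sum using (inj₁; inj₂)
open import Data.Vec using ([]; _∷_; lookup)
open import Data.Vec.Properties using ([]=⇒lookup)
open import Data.Nat.Tactic.RingSolver using (solve-∀)
open import Relation.Binary.PropositionalEquality
open import Relation.Nullary using (¬_)
open import Algebra.Properties.CommutativeMonoid.Sum +-0-commutativeMonoid using (sum; sum-cong-≗; sum-permute)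
open import Algebra.Properties.CommutativeSemigroup +-commutativeSemigroup
  using () renaming (interchange to +-interchange; x∙yz≈yx∙z to +-x∙yz≈yx∙z)
open import Algebra.Properties.CommutativeSemigroup *-commutativeSemigroup
  using () renaming (x∙yz≈y∙xz to *-x∙yz≈y∙xz)

∑< : ℕ → (ℕ → ℕ) → ℕ
∑< zero    f = 0
∑< (suc n) f = f 0 + ∑< n (λ i → f (suc i))

syntax ∑< n (λ i → x) = ∑[ i < n ] x

∑-cong : ∀ n {f g : ℕ → ℕ} → (∀ i → i < n → f i ≡ g i) → ∑< n f ≡ ∑< n g
∑-cong zero    f≡g = refl
∑-cong (suc n) f≡g = cong₂ _+_ (f≡g 0 z<s) (∑-cong n (λ i i<n → f≡g (suc i) (s<s i<n)))

∑-mono-≤ : ∀ n {f g : ℕ → ℕ} → (∀ i → i < n → f i ≤ g i) → ∑< n f ≤ ∑< n g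
∑-mono-≤ zero    f≤g = z≤n
∑-mono-≤ (suc n) f≤g = +-mono-≤ (f≤g 0 z<s) (∑-mono-≤ n (λ i i<n → f≤g (suc i) (s<s i<n)))

term≤∑ : ∀ n (f : ℕ → ℕ) {i} → i < n → f i ≤ ∑< n f
term≤∑ (suc n) f {zero}  _         = m≤m+n (f 0) _
term≤∑ (suc n) f {suc i} (s<s i<n) = ≤-trans (term≤∑ n (λ j → f (suc j)) i<n) (m≤n+m _ (f 0))

∑-const : ∀ n c → ∑[ _ < n ] c ≡ n * c
∑-const zero    c = refl
∑-const (suc n) c = cong (c +_) (∑-const n c)

∑-distrib-+ : ∀ n (f g : ℕ → ℕ) → ∑[ i < n ] (f i + g i) ≡ ∑< n f + ∑< n g
∑-distrib-+ zero    f g = refl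
∑-distrib-+ (suc n) f g =
  trans (cong (f 0 + g 0 +_) (∑-distrib-+ n (λ i → f (suc i)) (λ i → g (suc i))))
        (+-interchange (f 0) (g 0) _ _)

*-distribˡ-∑ : ∀ n c (f : ℕ → ℕ) → ∑[ i < n ] (c * f i) ≡ c * ∑< n f
*-distribˡ-∑ zero    c f = sym (*-zeroʳ c)
*-distribˡ-∑ (suc n) c f =
  trans (cong (c * f 0 +_) (*-distribˡ-∑ n c (λ i → f (suc i)))) (sym (*-distribˡ-+ c (f 0) _))

∑-++ : ∀ m n (f : ℕ → ℕ) → ∑< (m + n) f ≡ ∑< m f + ∑[ i < n ] f (m + i)
∑-++ zero    n f = refl
∑-++ (suc m) n f = trans (cong (f 0 +_) (∑-++ m n (λ i → f (suc i)))) (sym (+-assoc (f 0) _ _))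

∑-* : ∀ a c (f : ℕ → ℕ) → ∑< (a * c) f ≡ ∑[ q < a ] ∑[ r < c ] f (q * c + r)
∑-* zero    c f = refl
∑-* (suc a) c f = begin
  ∑< (c + a * c) f                                          ≡⟨ ∑-++ c (a * c) f ⟩
  ∑< c f + ∑[ i < a * c ] f (c + i)                         ≡⟨ cong (∑< c f +_) (∑-* a c (λ i → f (c + i))) ⟩
  ∑< c f + ∑[ q < a ] ∑[ r < c ] f (c + (q * c + r))        ≡⟨ cong (∑< c f +_) (∑-cong a λ q _ → ∑-cong c λ r _ →
                                                                  cong f (sym (+-assoc c (q * c) r))) ⟩
  ∑< c f + ∑[ q < a ] ∑[ r < c ] f (suc q * c + r)          ∎
  where open ≡-Reasoning

∑-comm : ∀ a b (f : ℕ → ℕ → ℕ) → ∑[ i < a ] ∑[ j < b ] f i j ≡ ∑[ j < b ] ∑[ i < a ] f i j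
∑-comm zero    b f = sym (trans (∑-const b 0) (*-zeroʳ b))
∑-comm (suc a) b f =
  trans (cong (∑< b (f 0) +_) (∑-comm a b (λ i → f (suc i))))
        (sym (∑-distrib-+ b (f 0) (λ j → ∑[ i < a ] f (suc i) j)))

∑≡sum : ∀ n (f : ℕ → ℕ) → ∑< n f ≡ sum (λ (i : Fin n) → f (toℕ i))
∑≡sum zero    f = refl
∑≡sum (suc n) f = cong (f 0 +_) (∑≡sum n (λ i → f (suc i)))

∑-reindex : ∀ n (σ τ : ℕ → ℕ) →
            (∀ x → x < n → σ x < n) → (∀ x → x < n → τ x < n) →
            (∀ x → x < n → σ (τ x) ≡ x) → (∀ x → x < n → τ (σ x) ≡ x) →
            ∀ (f : ℕ → ℕ) → ∑[ x < n ] f (σ x) ≡ ∑< n f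
∑-reindex n σ τ σ< τ< στ τσ f = begin
  ∑[ x < n ] f (σ x)                 ≡⟨ ∑≡sum n (λ x → f (σ x)) ⟩
  sum {n} (λ i → f (σ (toℕ i)))      ≡⟨ sum-cong-≗ {n} (λ i → cong f (Fin.toℕ-fromℕ< (σ< (toℕ i) (Fin.toℕ<n i)))) ⟨
  sum {n} (λ i → f (toℕ (σ′ i)))     ≡⟨ sum-permute (λ i → f (toℕ i)) π ⟨
  sum {n} (λ i → f (toℕ i))          ≡⟨ ∑≡sum n f ⟨
  ∑< n f                             ∎
  where
  open ≡-Reasoning
  onFin : (g : ℕ → ℕ) → (∀ x → x < n → g x < n) → Fin n → Fin n
  onFin g g< i = fromℕ< (g< (toℕ i) (Fin.toℕ<n i))
  inverse : ∀ {g h} g< h< → (∀ x → x < n → g (h x) ≡ x) → ∀ i → onFin g g< (onFin h h< i) ≡ i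
  inverse {g} {h} g< h< gh i = Fin.toℕ-injective (begin
    toℕ (onFin g g< (onFin h h< i))  ≡⟨ Fin.toℕ-fromℕ< _ ⟩
    g (toℕ (onFin h h< i))           ≡⟨ cong g (Fin.toℕ-fromℕ< _) ⟩
    g (h (toℕ i))                    ≡⟨ gh (toℕ i) (Fin.toℕ<n i) ⟩
    toℕ i                            ∎)
  σ′ : Fin n → Fin n
  σ′ = onFin σ σ<
  π : Permutation n n
  π = permutation σ′ (onFin τ τ<) (inverse σ< τ< στ) (inverse τ< σ< τσ)

m*[n%o]%o≡m*n%o : ∀ m n o .{{_ : NonZero o}} → (m * (n % o)) % o ≡ (m * n) % o
m*[n%o]%o≡m*n%o m n o = begin
  (m * (n % o)) % o              ≡⟨ %-distribˡ-* m (n % o) o ⟩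
  ((m % o) * (n % o % o)) % o    ≡⟨ cong (λ t → ((m % o) * t) % o) (m%n%n≡m%n n o) ⟩
  ((m % o) * (n % o)) % o        ≡⟨ %-distribˡ-* m n o ⟨
  (m * n) % o                    ∎
  where open ≡-Reasoning

m*n%[m*o]≡m*[n%o] : ∀ m n o .{{_ : NonZero m}} .{{_ : NonZero o}} →
                    _%_ (m * n) (m * o) {{m*n≢0 m o}} ≡ m * (n % o)
m*n%[m*o]≡m*[n%o] m n o = begin
  _%_ (m * n) (m * o) {{m*n≢0 m o}}  ≡⟨ %-congʳ {{m*n≢0 m o}} {{m*n≢0 o m}} (*-comm m o) ⟩
  _%_ (m * n) (o * m) {{m*n≢0 o m}}  ≡⟨ cong (λ t → _%_ t (o * m) {{m*n≢0 o m}}) (*-comm m n) ⟩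
  _%_ (n * m) (o * m) {{m*n≢0 o m}}  ≡⟨ m%n*o≡m*o%[n*o] n o m {{_}} {{m*n≢0 o m}} ⟨
  (n % o) * m                        ≡⟨ *-comm (n % o) m ⟩
  m * (n % o)                        ∎
  where open ≡-Reasoning

coprime-^ : ∀ {k n} → Coprime k n → ∀ e → Coprime k (n ^ e)
coprime-^ k⊥n zero    (_ , i∣1)        = ∣1⇒≡1 i∣1
coprime-^ k⊥n (suc e) (i∣k , i∣n*nᵉ) =
  coprime-^ k⊥n e (i∣k , coprime-divisor (λ (j∣i , j∣n) → k⊥n (∣-trans j∣i i∣k , j∣n)) i∣n*nᵉ)

-- In the second Bézout case 1 + x k ≡ y N, so -x, that is (N - 1) x, inverts k.
coprime⇒inverse : ∀ {k N} .{{_ : NonZero N}} → Coprime k N → ∃ λ a → (a * k) % N ≡ 1 % N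
coprime⇒inverse {k} {N} k⊥N with coprime-Bézout k⊥N
... | Bézout.+- x y 1+yN≡xk = x , trans (cong (_% N) (sym 1+yN≡xk)) ([m+kn]%n≡m%n 1 y N)
coprime⇒inverse {k} {N@(suc n)} k⊥N | Bézout.-+ x y 1+xk≡yN = n * x , (begin
  (n * x * k) % N                ≡⟨ [m+kn]%n≡m%n (n * x * k) 1 N ⟨
  (n * x * k + 1 * N) % N        ≡⟨ cong (_% N) (regroup n x k) ⟩
  (1 + n * (1 + x * k)) % N      ≡⟨ cong (λ t → (1 + n * t) % N) 1+xk≡yN ⟩
  (1 + n * (y * N)) % N          ≡⟨ cong (λ t → (1 + t) % N) (*-assoc n y N) ⟨
  (1 + n * y * N) % N            ≡⟨ [m+kn]%n≡m%n 1 (n * y) N ⟩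
  1 % N                          ∎)
  where
  open ≡-Reasoning
  regroup : ∀ n x k → n * x * k + 1 * suc n ≡ 1 + n * (1 + x * k)
  regroup = solve-∀

∑-%-*-coprime : ∀ N {k} .{{_ : NonZero N}} → Coprime k N →
                ∀ (f : ℕ → ℕ) → ∑[ x < N ] f ((k * x) % N) ≡ ∑< N f
∑-%-*-coprime N {k} k⊥N f with coprime⇒inverse k⊥N
... | a , ak≡1 = ∑-reindex N (λ x → (k * x) % N) (λ x → (a * x) % N)
  (λ x _ → m%n<n (k * x) N) (λ x _ → m%n<n (a * x) N)
  (λ x x<N → cancel k a x<N (trans (cong (_% N) (*-comm k a)) ak≡1))
  (λ x x<N → cancel a k x<N ak≡1) f
  where
  cancel : ∀ u v {y} → y < N → (u * v) % N ≡ 1 % N → (u * ((v * y) % N)) % N ≡ y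
  cancel u v {y} y<N uv≡1 = begin
    (u * ((v * y) % N)) % N          ≡⟨ m*[n%o]%o≡m*n%o u (v * y) N ⟩
    (u * (v * y)) % N                ≡⟨ cong (_% N) (*-assoc u v y) ⟨
    (u * v * y) % N                  ≡⟨ %-distribˡ-* (u * v) y N ⟩
    ((u * v) % N * (y % N)) % N      ≡⟨ cong (λ t → (t * (y % N)) % N) uv≡1 ⟩
    (1 % N * (y % N)) % N            ≡⟨ %-distribˡ-* 1 y N ⟨
    (1 * y) % N                      ≡⟨ cong (_% N) (*-identityˡ y) ⟩
    y % N                            ≡⟨ m<n⇒m%n≡m y<N ⟩
    y                                ∎
    where open ≡-Reasoning

*-+-< : ∀ {z r a c} → z < a → r < c → z * c + r < a * c
*-+-< {z} {r} {a} {c} z<a r<c = begin-strict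
  z * c + r    <⟨ +-monoʳ-< (z * c) r<c ⟩
  z * c + c    ≡⟨ +-comm (z * c) c ⟩
  suc z * c    ≤⟨ *-monoˡ-≤ c z<a ⟩
  a * c        ∎
  where open ≤-Reasoning

complement-bound : ∀ {a c N m} → 1 ≤ m → a + c ≡ N → N ≤ m * c → a * m ≤ (m ∸ 1) * N
complement-bound {a} {c} {N} {suc m} _ a+c≡N N≤m*c = +-cancelʳ-≤ N (a * suc m) (m * N) (begin
  a * suc m + N            ≤⟨ +-monoʳ-≤ (a * suc m) N≤m*c ⟩
  a * suc m + suc m * c    ≡⟨ distrib a c m ⟩
  (a + c) * suc m          ≡⟨ cong (_* suc m) a+c≡N ⟩
  N * suc m                ≡⟨ *-suc-comm N m ⟩
  m * N + N                ∎)
  where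
  open ≤-Reasoning
  distrib : ∀ a c m → a * suc m + suc m * c ≡ (a + c) * suc m
  distrib = solve-∀
  *-suc-comm : ∀ N m → N * suc m ≡ m * N + N
  *-suc-comm = solve-∀

𝟙 : Bool → ℕ
𝟙 true  = 1
𝟙 false = 0

𝟙[_≢0] : ℕ → ℕ
𝟙[ zero  ≢0] = 0
𝟙[ suc _ ≢0] = 1

∣p∣≡sum-𝟙∘lookup : ∀ {n} (S : Subset n) → ∣ S ∣ ≡ sum (λ i → 𝟙 (lookup S i))
∣p∣≡sum-𝟙∘lookup []            = refl
∣p∣≡sum-𝟙∘lookup (inside  ∷ S) = cong suc (∣p∣≡sum-𝟙∘lookup S)
∣p∣≡sum-𝟙∘lookup (outside ∷ S) = ∣p∣≡sum-𝟙∘lookup S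

module _ {N : ℕ} .{{_ : NonZero N}} where

  toℕ-mod : ∀ (i : Fin N) → toℕ i mod N ≡ i
  toℕ-mod i = Fin.toℕ-injective (trans (Fin.toℕ-fromℕ< _) (m<n⇒m%n≡m (Fin.toℕ<n i)))

  %-mod : ∀ y → (y % N) mod N ≡ y mod N
  %-mod y = Fin.toℕ-injective (trans (Fin.toℕ-fromℕ< _) (trans (m%n%n≡m%n y N) (sym (Fin.toℕ-fromℕ< _))))

  ∑-𝟙-lookup-mod : ∀ (S : Subset N) → ∑[ y < N ] 𝟙 (lookup S (y mod N)) ≡ ∣ S ∣
  ∑-𝟙-lookup-mod S = begin
    ∑[ y < N ] 𝟙 (lookup S (y mod N))          ≡⟨ ∑≡sum N (λ y → 𝟙 (lookup S (y mod N))) ⟩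
    sum {N} (λ i → 𝟙 (lookup S (toℕ i mod N)))  ≡⟨ sum-cong-≗ {N} (λ i → cong (λ j → 𝟙 (lookup S j)) (toℕ-mod i)) ⟩
    sum {N} (λ i → 𝟙 (lookup S i))             ≡⟨ ∣p∣≡sum-𝟙∘lookup S ⟨
    ∣ S ∣                                       ∎
    where open ≡-Reasoning

  multFree⇒∁-hitting : ∀ {m A} → MultFree m A → ∀ x → x < N → ∃ λ k → 0 < k × k ≤ m × (k * x) mod N ∈ ∁ A
  multFree⇒∁-hitting {m} {A} free x x<N =
    let i , kx∉A = Fin.¬∀⟶∃¬ m (λ i → (suc (toℕ i) · x′) ∈ A) (λ i → _ ∈? A) ¬all-in
    in  suc (toℕ i) , z<s , Fin.toℕ<n i ,
        subst (_∈ ∁ A) (cong (λ y → (suc (toℕ i) * y) mod N) (Fin.toℕ-fromℕ< x<N)) (x∉p⇒x∈∁p kx∉A)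
    where
    x′ = fromℕ< x<N
    ¬all-in : ¬ (∀ i → (suc (toℕ i) · x′) ∈ A)
    ¬all-in all-in = free (x′ , λ where
      (suc k) _ k≤m → subst (λ j → (suc j · x′) ∈ A) (Fin.toℕ-fromℕ< k≤m) (all-in (fromℕ< k≤m)))

-- A subset of ℤ_{p^L} is a predicate ℕ → Bool read below p^L; restricting it to the
-- multiples of p and identifying pℤ_{p^(L+1)} with ℤ_{p^L} is then precomposition with p *_.
module PrimePowerModulus {p-1 : ℕ} (p-prime : Prime (suc p-1)) where

  p : ℕ
  p = suc p-1

  p>1 : 1 < p
  p>1 = nonTrivial⇒n>1 p {{prime⇒nonTrivial p-prime}}

  instance
    p-1≢0 : NonZero p-1
    p-1≢0 = >-nonZero (≤-pred p>1)

  p^≢0 : ∀ L → NonZero (p ^ L)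
  p^≢0 L = m^n≢0 p L

  _%p^_ : ℕ → ℕ → ℕ
  x %p^ L = _%_ x (p ^ L) {{p^≢0 L}}

  count : ℕ → (ℕ → Bool) → ℕ
  count L B = ∑[ x < p ^ L ] 𝟙 (B x)

  scale : ℕ → ℕ → (ℕ → Bool) → ℕ → Bool
  scale L k B x = B ((k * x) %p^ L)

  dilate : (ℕ → Bool) → ℕ → Bool
  dilate B z = B (p * z)

  incidences : ℕ → ℕ → (ℕ → Bool) → ℕ
  incidences L D B = ∑[ k < p ^ D ] (𝟙[ k ≢0] * count L (scale L k B))

  Hitting : ℕ → ℕ → (ℕ → Bool) → Set
  Hitting d L B = ∀ x → x < p ^ L → ∃ λ k → 0 < k × k < p ^ d × scale L k B x ≡ true

  *-%p^-suc : ∀ L y → (p * y) %p^ suc L ≡ p * (y %p^ L)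
  *-%p^-suc L y = m*n%[m*o]≡m*[n%o] p y (p ^ L) {{_}} {{p^≢0 L}}

  coprime-unit : ∀ q j → suc j < p → Coprime (q * p + suc j) p
  coprime-unit q j j<p (i∣q*p+j , i∣p) =
    prime⇒coprime p-prime j<p (i∣p , ∣m+n∣m⇒∣n i∣q*p+j (∣-trans i∣p (n∣m*n q)))

  count-scale-coprime : ∀ L {k} B → Coprime k p → count L (scale L k B) ≡ count L B
  count-scale-coprime L B k⊥p =
    ∑-%-*-coprime (p ^ L) {{p^≢0 L}} (coprime-^ k⊥p L) (λ y → 𝟙 (B y))

  count-scale-p* : ∀ L k B → count (suc L) (scale (suc L) (p * k) B) ≡ p * count L (scale L k (dilate B))
  count-scale-p* L k B = begin
    ∑[ x < p * p ^ L ] 𝟙 (B ((p * k * x) %p^ suc L))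
      ≡⟨ ∑-* p (p ^ L) _ ⟩
    ∑[ q < p ] ∑[ r < p ^ L ] 𝟙 (B ((p * k * (q * p ^ L + r)) %p^ suc L))
      ≡⟨ ∑-cong p (λ q _ → ∑-cong (p ^ L) λ r _ → cong (λ y → 𝟙 (B y)) (residue q r)) ⟩
    ∑[ q < p ] count L (scale L k (dilate B))
      ≡⟨ ∑-const p _ ⟩
    p * count L (scale L k (dilate B))
      ∎
    where
    open ≡-Reasoning
    regroup : ∀ p k q P r → p * k * (q * P + r) ≡ p * (k * r + k * q * P)
    regroup = solve-∀
    residue : ∀ q r → (p * k * (q * p ^ L + r)) %p^ suc L ≡ p * ((k * r) %p^ L)
    residue q r = begin
      (p * k * (q * p ^ L + r)) %p^ suc L      ≡⟨ cong (_%p^ suc L) (regroup p k q (p ^ L) r) ⟩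
      (p * (k * r + k * q * p ^ L)) %p^ suc L  ≡⟨ *-%p^-suc L _ ⟩
      p * ((k * r + k * q * p ^ L) %p^ L)      ≡⟨ cong (p *_) ([m+kn]%n≡m%n (k * r) (k * q) (p ^ L) {{p^≢0 L}}) ⟩
      p * ((k * r) %p^ L)                      ∎

  incidences-units-block : ∀ L B q →
    ∑[ j < p-1 ] (𝟙[ q * p + suc j ≢0] * count L (scale L (q * p + suc j) B)) ≡ p-1 * count L B
  incidences-units-block L B q = trans (∑-cong p-1 unit) (∑-const p-1 (count L B))
    where
    unit : ∀ j → j < p-1 → 𝟙[ q * p + suc j ≢0] * count L (scale L (q * p + suc j) B) ≡ count L B
    unit j j<p-1 = begin
      𝟙[ q * p + suc j ≢0] * count L (scale L (q * p + suc j) B)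
        ≡⟨ cong (λ n → 𝟙[ n ≢0] * count L (scale L (q * p + suc j) B)) (+-suc (q * p) j) ⟩
      1 * count L (scale L (q * p + suc j) B)
        ≡⟨ *-identityˡ _ ⟩
      count L (scale L (q * p + suc j) B)
        ≡⟨ count-scale-coprime L B (coprime-unit q j (s<s j<p-1)) ⟩
      count L B
        ∎
      where open ≡-Reasoning

  incidences-1 : ∀ L B → incidences L 1 B ≡ p-1 * count L B
  incidences-1 L B = begin
    ∑[ j < p-1 * 1 ] (1 * count L (scale L (suc j) B))  ≡⟨ cong (λ n → ∑[ j < n ] (1 * count L (scale L (suc j) B))) (*-identityʳ p-1) ⟩
    ∑[ j < p-1 ] (1 * count L (scale L (suc j) B))      ≡⟨ incidences-units-block L B 0 ⟩
    p-1 * count L B                                      ∎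
    where open ≡-Reasoning

  incidences-suc : ∀ L D B →
    incidences (suc L) (suc D) B ≡ p * incidences L D (dilate B) + p ^ D * (p-1 * count (suc L) B)
  incidences-suc L D B = begin
    ∑< (p * p ^ D) F                                      ≡⟨ cong (λ n → ∑< n F) (*-comm p (p ^ D)) ⟩
    ∑< (p ^ D * p) F                                      ≡⟨ ∑-* (p ^ D) p F ⟩
    ∑[ q < p ^ D ] ∑[ r < p ] F (q * p + r)               ≡⟨ ∑-cong (p ^ D) (λ q _ → cong₂ _+_ (multiple-of-p q) (incidences-units-block (suc L) B q)) ⟩
    ∑[ q < p ^ D ] (p * G q + p-1 * count (suc L) B)      ≡⟨ ∑-distrib-+ (p ^ D) _ _ ⟩
    ∑[ q < p ^ D ] (p * G q) + ∑[ _ < p ^ D ] (p-1 * count (suc L) B)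
                                                          ≡⟨ cong₂ _+_ (*-distribˡ-∑ (p ^ D) p G) (∑-const (p ^ D) _) ⟩
    p * incidences L D (dilate B) + p ^ D * (p-1 * count (suc L) B)
                                                          ∎
    where
    open ≡-Reasoning
    F : ℕ → ℕ
    F k = 𝟙[ k ≢0] * count (suc L) (scale (suc L) k B)
    G : ℕ → ℕ
    G q = 𝟙[ q ≢0] * count L (scale L q (dilate B))
    multiple-of-p : ∀ q → F (q * p + 0) ≡ p * G q
    multiple-of-p zero    = sym (*-zeroʳ p)
    multiple-of-p (suc q) = begin
      1 * count (suc L) (scale (suc L) (suc q * p + 0) B)  ≡⟨ *-identityˡ _ ⟩
      count (suc L) (scale (suc L) (suc q * p + 0) B)      ≡⟨ cong (λ k → count (suc L) (scale (suc L) k B)) (trans (+-identityʳ _) (*-comm (suc q) p)) ⟩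
      count (suc L) (scale (suc L) (p * suc q) B)          ≡⟨ count-scale-p* L (suc q) B ⟩
      p * count L (scale L (suc q) (dilate B))             ≡⟨ cong (p *_) (*-identityˡ _) ⟨
      p * G (suc q)                                        ∎

  incidences-telescope : ∀ {D L} B → D ≤ L →
    incidences (suc L) (suc D) B + p ^ D * (p-1 * count (L ∸ D) (iterate dilate B (suc D))) ≡
    incidences L (suc D) (dilate B) + p ^ D * (p-1 * count (suc L) B)
  incidences-telescope {zero} {L} B _ = begin
    incidences (suc L) 1 B + 1 * (p-1 * count L (dilate B))
      ≡⟨ cong₂ (λ x y → x + 1 * y) (incidences-1 (suc L) B) (sym (incidences-1 L (dilate B))) ⟩
    p-1 * count (suc L) B + 1 * incidences L 1 (dilate B)
      ≡⟨ swap (p-1 * count (suc L) B) (incidences L 1 (dilate B)) ⟩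
    incidences L 1 (dilate B) + 1 * (p-1 * count (suc L) B)
      ∎
    where
    open ≡-Reasoning
    swap : ∀ x y → x + 1 * y ≡ y + 1 * x
    swap = solve-∀
  incidences-telescope {suc D} {suc L} B (s≤s D≤L) = begin
    incidences (2 + L) (2 + D) B + p * p ^ D * Z
      ≡⟨ cong (_+ p * p ^ D * Z) (incidences-suc (suc L) (suc D) B) ⟩
    p * incidences (suc L) (suc D) (dilate B) + p * p ^ D * X + p * p ^ D * Z
      ≡⟨ factor-p p _ (p ^ D) X Z ⟩
    p * (incidences (suc L) (suc D) (dilate B) + p ^ D * Z) + p * p ^ D * X
      ≡⟨ cong (λ t → p * t + p * p ^ D * X) (incidences-telescope (dilate B) D≤L) ⟩
    p * (incidences L (suc D) (dilate (dilate B)) + p ^ D * Y) + p * p ^ D * X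
      ≡⟨ cong (_+ p * p ^ D * X) (distrib p _ (p ^ D) Y) ⟩
    p * incidences L (suc D) (dilate (dilate B)) + p * p ^ D * Y + p * p ^ D * X
      ≡⟨ cong (_+ p * p ^ D * X) (incidences-suc L (suc D) (dilate B)) ⟨
    incidences (suc L) (2 + D) (dilate B) + p * p ^ D * X
      ∎
    where
    open ≡-Reasoning
    X = p-1 * count (2 + L) B
    Y = p-1 * count (suc L) (dilate B)
    Z = p-1 * count (L ∸ D) (iterate dilate B (2 + D))
    factor-p : ∀ p a P X Z → p * a + p * P * X + p * P * Z ≡ p * (a + P * Z) + p * P * X
    factor-p = solve-∀
    distrib : ∀ p b P Y → p * (b + P * Y) ≡ p * b + p * P * Y
    distrib = solve-∀

  multiplicity : ℕ → ℕ → (ℕ → Bool) → ℕ → ℕ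
  multiplicity L D B x = ∑[ k < p ^ D ] (𝟙[ k ≢0] * 𝟙 (scale L k B x))

  incidences-by-point : ∀ L D B → incidences L D B ≡ ∑[ x < p ^ L ] multiplicity L D B x
  incidences-by-point L D B = trans
    (∑-cong (p ^ D) λ k _ → sym (*-distribˡ-∑ (p ^ L) 𝟙[ k ≢0] (λ x → 𝟙 (scale L k B x))))
    (∑-comm (p ^ D) (p ^ L) λ k x → 𝟙[ k ≢0] * 𝟙 (scale L k B x))

  scale-dilate : ∀ L k B z → scale (suc L) k B (p * z) ≡ scale L k (dilate B) z
  scale-dilate L k B z = cong B (begin
    (k * (p * z)) %p^ suc L   ≡⟨ cong (_%p^ suc L) (*-x∙yz≈y∙xz k p z) ⟩
    (p * (k * z)) %p^ suc L   ≡⟨ *-%p^-suc L (k * z) ⟩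
    p * ((k * z) %p^ L)       ∎)
    where
    open ≡-Reasoning

  multiplicity-p* : ∀ L D B z → multiplicity (suc L) D B (p * z) ≡ multiplicity L D (dilate B) z
  multiplicity-p* L D B z = ∑-cong (p ^ D) λ k _ → cong (λ b → 𝟙[ k ≢0] * 𝟙 b) (scale-dilate L k B z)

  hitting⇒multiplicity≥1 : ∀ {d L B} → Hitting d L B → ∀ x → x < p ^ L → 1 ≤ multiplicity L d B x
  hitting⇒multiplicity≥1 {d} {L} {B} hit x x<p^L with hit x x<p^L
  ... | k@(suc _) , _ , k<p^d , kx∈B = begin
    1                                         ≡⟨ cong (λ b → 1 * 𝟙 b) kx∈B ⟨
    1 * 𝟙 (scale L k B x)                     ≤⟨ term≤∑ (p ^ d) (λ k → 𝟙[ k ≢0] * 𝟙 (scale L k B x)) k<p^d ⟩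
    multiplicity L d B x                      ∎
    where open ≤-Reasoning

  hitting⇒incidences-step : ∀ {d L} B → Hitting d (suc L) B →
    p ^ L * p-1 + incidences L d (dilate B) ≤ incidences (suc L) d B
  hitting⇒incidences-step {d} {L} B hit = begin
    p ^ L * p-1 + incidences L d (dilate B)
      ≡⟨ cong₂ _+_ (sym (∑-const (p ^ L) p-1)) (incidences-by-point L d (dilate B)) ⟩
    ∑[ _ < p ^ L ] p-1 + ∑[ z < p ^ L ] μ′ z
      ≡⟨ ∑-distrib-+ (p ^ L) (λ _ → p-1) μ′ ⟨
    ∑[ z < p ^ L ] (p-1 + μ′ z)
      ≤⟨ ∑-mono-≤ (p ^ L) block ⟩
    ∑[ z < p ^ L ] ∑[ r < p ] μ (z * p + r)
      ≡⟨ ∑-* (p ^ L) p μ ⟨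
    ∑< (p ^ L * p) μ
      ≡⟨ cong (λ n → ∑< n μ) (*-comm (p ^ L) p) ⟩
    ∑< (p ^ suc L) μ
      ≡⟨ incidences-by-point (suc L) d B ⟨
    incidences (suc L) d B
      ∎
    where
    open ≤-Reasoning
    μ μ′ : ℕ → ℕ
    μ  = multiplicity (suc L) d B
    μ′ = multiplicity L d (dilate B)
    block : ∀ z → z < p ^ L → p-1 + μ′ z ≤ ∑[ r < p ] μ (z * p + r)
    block z z<p^L = begin
      p-1 + μ′ z
        ≡⟨ +-comm p-1 (μ′ z) ⟩
      μ′ z + p-1
        ≡⟨ cong₂ _+_ (sym (trans (cong μ (trans (+-identityʳ _) (*-comm z p))) (multiplicity-p* L d B z)))
                     (sym (trans (∑-const p-1 1) (*-identityʳ p-1))) ⟩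
      μ (z * p + 0) + ∑[ _ < p-1 ] 1
        ≤⟨ +-monoʳ-≤ (μ (z * p + 0)) (∑-mono-≤ p-1 λ j j<p-1 →
             hitting⇒multiplicity≥1 {d} {suc L} {B} hit (z * p + suc j)
               (≤-trans (*-+-< z<p^L (s<s j<p-1)) (≤-reflexive (*-comm (p ^ L) p)))) ⟩
      μ (z * p + 0) + ∑[ j < p-1 ] μ (z * p + suc j)
        ∎

  p^D*p^[L∸D]≡p^L : ∀ {D L} → D ≤ L → p ^ D * p ^ (L ∸ D) ≡ p ^ L
  p^D*p^[L∸D]≡p^L {D} {L} D≤L = trans (sym (^-distribˡ-+-* p D (L ∸ D))) (cong (p ^_) (m+[n∸m]≡n D≤L))

  -- I - I′ (below) is at least p^L (p - 1), the number of units, and equals p^D (p - 1) times the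
  -- number of elements of B not divisible by p^(D+1).
  hitting⇒count-step : ∀ {D L} B → Hitting (suc D) (suc L) B → D ≤ L →
    p ^ (L ∸ D) + count (L ∸ D) (iterate dilate B (suc D)) ≤ count (suc L) B
  hitting⇒count-step {D} {L} B hit D≤L = *-cancelˡ-≤ (p ^ D * p-1) {{m*n≢0 (p ^ D) p-1 {{p^≢0 D}}}} (begin
    p ^ D * p-1 * (p ^ (L ∸ D) + C′)     ≡⟨ expand (p ^ D) p-1 (p ^ (L ∸ D)) C′ ⟩
    p ^ D * p ^ (L ∸ D) * p-1 + p ^ D * (p-1 * C′)
                                         ≡⟨ cong (λ n → n * p-1 + p ^ D * (p-1 * C′)) (p^D*p^[L∸D]≡p^L D≤L) ⟩
    p ^ L * p-1 + p ^ D * (p-1 * C′)     ≤⟨ +-cancelˡ-≤ I′ _ _ (begin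
      I′ + (p ^ L * p-1 + p ^ D * (p-1 * C′))  ≡⟨ +-x∙yz≈yx∙z I′ (p ^ L * p-1) _ ⟩
      p ^ L * p-1 + I′ + p ^ D * (p-1 * C′)    ≤⟨ +-monoˡ-≤ _ (hitting⇒incidences-step {suc D} {L} B hit) ⟩
      I + p ^ D * (p-1 * C′)                   ≡⟨ incidences-telescope B D≤L ⟩
      I′ + p ^ D * (p-1 * C)                   ∎) ⟩
    p ^ D * (p-1 * C)                    ≡⟨ *-assoc (p ^ D) p-1 C ⟨
    p ^ D * p-1 * C                      ∎)
    where
    open ≤-Reasoning
    C = count (suc L) B
    C′ = count (L ∸ D) (iterate dilate B (suc D))
    I = incidences (suc L) (suc D) B
    I′ = incidences L (suc D) (dilate B)
    expand : ∀ P q Q C′ → P * q * (Q + C′) ≡ P * Q * q + P * (q * C′)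
    expand = solve-∀

  hitting-dilate : ∀ {d L B} → Hitting d (suc L) B → Hitting d L (dilate B)
  hitting-dilate {d} {L} {B} hit z z<p^L with hit (p * z) (*-monoʳ-< p z<p^L)
  ... | k , 0<k , k<p^d , kpz∈B = k , 0<k , k<p^d , trans (sym (scale-dilate L k B z)) kpz∈B

  hitting-dilate^ : ∀ n {d L B} → Hitting d (n + L) B → Hitting d L (iterate dilate B n)
  hitting-dilate^ zero    hit = hit
  hitting-dilate^ (suc n) {d} {L} {B} hit = hitting-dilate^ n {d} {L} {dilate B} (hitting-dilate {d} {n + L} {B} hit)

  hitting⇒count≥1 : ∀ {d L B} → Hitting d L B → 1 ≤ count L B
  hitting⇒count≥1 {d} {L} {B} hit with hit 0 (m^n>0 p L)
  ... | k , _ , _ , k0∈B = begin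
    1                           ≡⟨ cong 𝟙 k0∈B ⟨
    𝟙 (scale L k B 0)           ≤⟨ term≤∑ (p ^ L) (λ x → 𝟙 (B x)) (m%n<n (k * 0) (p ^ L) {{p^≢0 L}}) ⟩
    count L B                   ∎
    where open ≤-Reasoning

  hitting⇒count-bound : ∀ D L B → Hitting (suc D) L B → p ^ L ≤ (p ^ suc D ∸ 1) * count L B
  hitting⇒count-bound D = <-rec _ bound
    where
    m = p ^ suc D ∸ 1
    Bound : ℕ → Set
    Bound L = ∀ B → Hitting (suc D) L B → p ^ L ≤ m * count L B
    large : ∀ {L} → suc D ≤ L → (∀ {e} → e < L → Bound e) → Bound L
    large {suc L} (s≤s D≤L) rec B hit = begin
      p ^ suc L                                   ≡⟨ p^D*p^[L∸D]≡p^L (s≤s D≤L) ⟨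
      p ^ suc D * p ^ e                           ≡⟨ cong (_* p ^ e) (suc-pred (p ^ suc D) {{p^≢0 (suc D)}}) ⟨
      p ^ e + m * p ^ e                           ≤⟨ +-monoˡ-≤ (m * p ^ e) (rec (s≤s (m∸n≤m L D)) B′ hit′) ⟩
      m * C′ + m * p ^ e                          ≡⟨ trans (+-comm (m * C′) _) (sym (*-distribˡ-+ m (p ^ e) C′)) ⟩
      m * (p ^ e + C′)                            ≤⟨ *-monoʳ-≤ m (hitting⇒count-step B hit D≤L) ⟩
      m * count (suc L) B                         ∎
      where
      open ≤-Reasoning
      e = L ∸ D
      B′ = iterate dilate B (suc D)
      C′ = count e B′
      hit′ : Hitting (suc D) e B′
      hit′ = hitting-dilate^ (suc D) {suc D} {e} {B} (subst (λ n → Hitting (suc D) n B) (sym (cong suc (m+[n∸m]≡n D≤L))) hit)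
    bound : ∀ L → (∀ {e} → e < L → Bound e) → Bound L
    bound L rec B hit with <-≤-connex L (suc D)
    ... | inj₁ L<d = begin
      p ^ L           ≤⟨ <⇒≤pred (^-monoʳ-< p p>1 L<d) ⟩
      m               ≡⟨ *-identityʳ m ⟨
      m * 1           ≤⟨ *-monoʳ-≤ m (hitting⇒count≥1 {suc D} {L} {B} hit) ⟩
      m * count L B   ∎
      where open ≤-Reasoning
    ... | inj₂ d≤L = large d≤L rec B hit

mainTheorem7 : (p l d : ℕ) → (pr : Prime p) → 0 < l → 0 < d →
    (A : Subset (p ^ l)) →
    MultFree {{prime^≢0 pr l}} (p ^ d ∸ 1) A →
    ∣ A ∣ * (p ^ d ∸ 1) ≤ (p ^ d ∸ 2) * (p ^ l)
mainTheorem7 zero      _ _       pr = ⊥-elim (NonZero.nonZero (prime⇒nonZero pr))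
mainTheorem7 (suc _)   _ zero    _  _ ()
mainTheorem7 (suc p-1) l (suc D) pr _ _ A free = begin
  ∣ A ∣ * m                ≤⟨ complement-bound m≥1 ∣A∣+∣B∣≡N (hitting⇒count-bound D l B B-hitting) ⟩
  (m ∸ 1) * p ^ l          ≡⟨ cong (_* p ^ l) (∸-+-assoc (p ^ suc D) 1 1) ⟩
  (p ^ suc D ∸ 2) * p ^ l  ∎
  where
  open PrimePowerModulus pr
  open ≤-Reasoning
  instance
    p^l≢0 : NonZero (p ^ l)
    p^l≢0 = p^≢0 l
  m = p ^ suc D ∸ 1
  m≥1 : 1 ≤ m
  m≥1 = <⇒≤pred (^-monoʳ-< p p>1 (z<s {D}))
  B : ℕ → Bool
  B y = lookup (∁ A) (y mod p ^ l)
  ∣A∣+∣B∣≡N : ∣ A ∣ + count l B ≡ p ^ l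
  ∣A∣+∣B∣≡N = trans (cong (∣ A ∣ +_) (trans (∑-𝟙-lookup-mod (∁ A)) (∣∁p∣≡n∸∣p∣ A))) (m+[n∸m]≡n (∣p∣≤n A))
  B-hitting : Hitting (suc D) l B
  B-hitting x x<N with multFree⇒∁-hitting free x x<N
  ... | k , 0<k , k≤m , kx∈∁A = k , 0<k , ≤-trans (s≤s k≤m) (≤-reflexive (suc-pred (p ^ suc D) {{p^≢0 (suc D)}})) ,
        trans (cong (lookup (∁ A)) (%-mod (k * x))) ([]=⇒lookup kx∈∁A)
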